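{- For integers $k\ge1$ and $N\ge k+1$, $$W_2(N,k)=\theta\,T_2(N,k)-\theta^{2N-2k+1}(P_{N-2})!\,P_kP_{k-1}$$ $$=\theta\,(P_k)!\Big\{(1+\theta^2P_{N-2})(1+\theta^2P_{N-3})\cdots(1+\theta^2P_k)(1+\theta^2P_{k-1})-\theta^{2N-2k}P_{N-2}P_{N-3}\cdots P_{k-1}\Big\}.$$
   Context: Let $\theta>0$. $\mathrm{inv}(\pi)$ is the number of pairs $i<j$ with $\pi_i>\pi_j$. $P_n=1+\theta+\cdots+\theta^{n-1}$ ($P_0=0$), $(P_n)!=P_n\cdots P_1$, $(P_0)!=1$. For $\pi\in S_n$, position $i$ is a left-to-right second maximum if exactly one $j<i$ has $\pi_j>\pi_i$. The strategy $S^2_k$ rejects the first $k$ candidates and then accepts the first subsequent left-to-right second maximum (if any). $\pi\in S_n$ is $k$-pickable if $S^2_k$ selects some position, and $k$-winnable if $S^2_k$ selects a position holding value $n-1$. $T_2(n,k)=\sum_{\pi\in S_n\text{ not }k\text{ -pickable}}\theta^{\mathrm{inv}(\pi)}$ and $W_2(n,k)=\sum_{\pi\in S_n\ k\text{ -winnable}}\theta^{\mathrm{inv}(\pi)}$.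
   Formalization: The parameter θ ranges over the positive rationals rather than the positive reals. -}

module Defs where

open import Data.Nat as Nat using (ℕ; zero; suc; _∸_; _≤ᵇ_; _<ᵇ_; _≡ᵇ_)
open import Data.Bool using (Bool; true; false; _∧_; if_then_else_; not)
open import Data.List using (List; []; _∷_; map; filter; length; concatMap; upTo; applyUpTo; foldr)
open import Data.Bool.ListAction using (any)
open import Data.Maybe using (Maybe; just; nothing)
open import Data.Rational using (ℚ; 0ℚ; 1ℚ; _+_; _*_)
open import Relation.Nullary.Decidable using (T?)
open import Function using (_∘_)

-- ## Permutations: S_n is the list of all words of length n over {1,…,n}
-- with pairwise distinct letters (one-line notation π₁ π₂ … πₙ).

words : List ℕ → ℕ → List (List ℕ)
words as zero    = [] ∷ []
words as (suc m) = concatMap (λ a → map (a ∷_) (words as m)) as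

memb : ℕ → List ℕ → Bool
memb x = any (x ≡ᵇ_)

distinct : List ℕ → Bool
distinct []       = true
distinct (x ∷ xs) = not (memb x xs) ∧ distinct xs

Sym : ℕ → List (List ℕ)
Sym n = filter (T? ∘ distinct) (words (map suc (upTo n)) n)

inv : List ℕ → ℕ
inv []       = 0
inv (x ∷ xs) = length (filter (λ y → T? (y <ᵇ x)) xs) Nat.+ inv xs

-- ## Strategy S²_k
-- go k π seen i : scan π; 'seen' = values at earlier positions, i = 0-based
-- index of the current position (1-based position i+1).  Position i+1 is
-- a left-to-right second maximum iff exactly one earlier value exceeds it.
-- The first k positions are rejected (i.e. accept only when i+1 > k, i.e. k ≤ i).
go : ℕ → List ℕ → List ℕ → ℕ → Maybe ℕ
go k []       seen i = nothing
go k (x ∷ xs) seen i =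
  if (k ≤ᵇ i) ∧ (length (filter (λ y → T? (x <ᵇ y)) seen) ≡ᵇ 1)
  then just x
  else go k xs (x ∷ seen) (suc i)

selectS2 : ℕ → List ℕ → Maybe ℕ
selectS2 k π = go k π [] 0

pickable : ℕ → List ℕ → Bool
pickable k π with selectS2 k π
... | just _  = true
... | nothing = false

winnable : ℕ → ℕ → List ℕ → Bool
winnable n k π with selectS2 k π
... | just v  = v ≡ᵇ (n ∸ 1)
... | nothing = false

_^_ : ℚ → ℕ → ℚ
x ^ zero  = 1ℚ
x ^ suc m = x * (x ^ m)

sumℚ : List ℚ → ℚ
sumℚ = foldr _+_ 0ℚ

prodℚ : List ℚ → ℚ
prodℚ = foldr _*_ 1ℚ

P : ℚ → ℕ → ℚ
P θ n = sumℚ (map (θ ^_) (upTo n))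

Pfact : ℚ → ℕ → ℚ
Pfact θ zero    = 1ℚ
Pfact θ (suc n) = P θ (suc n) * Pfact θ n

-- product of f j for a ≤ j ≤ b (empty if b < a)
prodFromTo : (ℕ → ℚ) → ℕ → ℕ → ℚ
prodFromTo f a b = prodℚ (map f (applyUpTo (a Nat.+_) (suc b ∸ a)))

T2 : ℚ → ℕ → ℕ → ℚ
T2 θ n k = sumℚ (map (λ π → θ ^ inv π) (filter (λ π → T? (not (pickable k π))) (Sym n)))

W2 : ℚ → ℕ → ℕ → ℚ
W2 θ n k = sumℚ (map (λ π → θ ^ inv π) (filter (λ π → T? (winnable n k π)) (Sym n)))

{-# OPTIONS --safe #-}
-- Split π ∈ S (n + 1) by its last letter a: the other letters standardise to some v ∈ S n, and
-- inv π = inv v + (n + 1 − a).  The strategy picks in π what it picks in v (shifted past a); failing that it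
-- picks the last letter exactly when k ≤ n and a = n, the only value with a single larger predecessor.
-- The runner-up n of π is either the runner-up n − 1 of v lifted past a < n, or a = n itself.  Summing over a,
-- for n ≥ k
--   T₂(n + 1, k) = (1 + θ² P_{n−1}) T₂(n, k),   W₂(n + 1, k) = θ² P_{n−1} W₂(n, k) + θ T₂(n, k),
-- while T₂(n, k) = (P_n)! and W₂(n, k) = 0 for n ≤ k.  Solving the recurrences gives the closed forms, and the
-- first identity follows from (P_{N−2})! P_k P_{k−1} = (P_k)! P_{k−1} ⋯ P_{N−2}.
module Submission where

open import Defs

-- A separate module keeps ℕ's _<_, used throughout, apart from ℚ's _<_ in the statement of theorem8.
module SecondMaximumStrategy where

  open import Algebra.Bundles using (CommutativeMonoid)
  open import Data.Bool using (Bool; true; false; _∧_; _∨_; if_then_else_; not; T)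
  open import Data.Bool.Properties using (T-≡; T-∧; ∨-identityʳ; ∨-assoc)
  open import Data.Empty using (⊥-elim)
  open import Data.List using (List; []; _∷_; map; filter; length; concatMap; upTo; applyUpTo; _++_; _∷ʳ_; reverseAcc)
  import Data.List.Properties as List
  open import Data.List.Relation.Unary.All as All using (All; []; _∷_)
  open import Data.Maybe as Maybe using (Maybe; just; nothing; _<∣>_)
  open import Data.Maybe.Properties using (just-injective)
  open import Data.Nat as ℕ using (ℕ; zero; suc; _≤_; _<_; _∸_; _≤ᵇ_; _<ᵇ_; _≡ᵇ_; z≤n; s≤s)
  import Data.Nat.Properties as ℕ
  import Algebra.Properties.CommutativeSemigroup ℕ.+-commutativeSemigroup as ℕ+
  open import Data.Product using (_×_; _,_; proj₁; proj₂)
  open import Data.Rational using (ℚ; 0ℚ; 1ℚ; _+_; _*_; _-_)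
  import Data.Rational.Properties as ℚ
  import Algebra.Properties.CommutativeSemigroup (CommutativeMonoid.commutativeSemigroup ℚ.+-0-commutativeMonoid) as ℚ+
  import Algebra.Properties.CommutativeSemigroup (CommutativeMonoid.commutativeSemigroup ℚ.*-1-commutativeMonoid) as ℚ*
  open import Data.Rational.Solver using (module +-*-Solver)
  open import Function using (_∘_; id; Equivalence)
  open import Relation.Binary.PropositionalEquality
  open import Relation.Binary using (_Preserves_⟶_; tri<; tri≈; tri>)
  open import Relation.Nullary using (¬_; yes; no)
  open import Relation.Nullary.Decidable using (T?)
  open +-*-Solver
  open ≡-Reasoning

  variable
    A B : Set

  T⇒≡true : ∀ {b} → T b → b ≡ true
  T⇒≡true = Equivalence.to T-≡

  ≡true⇒T : ∀ {b} → b ≡ true → T b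
  ≡true⇒T = Equivalence.from T-≡

  ¬T⇒≡false : ∀ {b} → ¬ T b → b ≡ false
  ¬T⇒≡false {true} ¬t = ⊥-elim (¬t _)
  ¬T⇒≡false {false} _ = refl

  T-cong : ∀ {b c} → (T b → T c) → (T c → T b) → b ≡ c
  T-cong {true} {true} _ _ = refl
  T-cong {true} {false} f _ = ⊥-elim (f _)
  T-cong {false} {true} _ g = ⊥-elim (g _)
  T-cong {false} {false} _ _ = refl

  ≡ᵇ-refl : ∀ m → (m ≡ᵇ m) ≡ true
  ≡ᵇ-refl m = T⇒≡true (ℕ.≡⇒≡ᵇ m m refl)

  ≡ᵇ-sym : ∀ m n → (m ≡ᵇ n) ≡ (n ≡ᵇ m)
  ≡ᵇ-sym m n = T-cong (ℕ.≡⇒≡ᵇ n m ∘ sym ∘ ℕ.≡ᵇ⇒≡ m n)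
                      (ℕ.≡⇒≡ᵇ m n ∘ sym ∘ ℕ.≡ᵇ⇒≡ n m)

  ≡ᵇ≡true⇒≡ : ∀ m n → (m ≡ᵇ n) ≡ true → m ≡ n
  ≡ᵇ≡true⇒≡ m n e = ℕ.≡ᵇ⇒≡ m n (≡true⇒T e)

  ≡ᵇ≡false⇒≢ : ∀ m n → (m ≡ᵇ n) ≡ false → m ≢ n
  ≡ᵇ≡false⇒≢ m n e m≡n = subst T e (ℕ.≡⇒≡ᵇ m n m≡n)

  ≢⇒≡ᵇ≡false : ∀ {m n} → m ≢ n → (m ≡ᵇ n) ≡ false
  ≢⇒≡ᵇ≡false {m} {n} m≢n = ¬T⇒≡false (m≢n ∘ ℕ.≡ᵇ⇒≡ m n)

  <⇒<ᵇ≡true : ∀ {m n} → m < n → (m <ᵇ n) ≡ true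
  <⇒<ᵇ≡true = T⇒≡true ∘ ℕ.<⇒<ᵇ

  ≮⇒<ᵇ≡false : ∀ {m n} → ¬ m < n → (m <ᵇ n) ≡ false
  ≮⇒<ᵇ≡false {m} {n} m≮n = ¬T⇒≡false (m≮n ∘ ℕ.<ᵇ⇒< m n)

  ∸≡1⇒≡ : ∀ {a n} → a ≤ suc n → suc n ∸ a ≡ 1 → a ≡ n
  ∸≡1⇒≡ {a} a≤1+n j≡1 = ℕ.suc-injective (trans (cong (ℕ._+ a) (sym j≡1)) (ℕ.m∸n+n≡m a≤1+n))

  if-∧-* : ∀ b c (x y : ℚ) → (if b ∧ c then x * y else 0ℚ) ≡ (if c then y else 0ℚ) * (if b then x else 0ℚ)
  if-∧-* true true x y = ℚ.*-comm x y
  if-∧-* true false x y = sym (ℚ.*-zeroˡ x)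
  if-∧-* false c x y = sym (ℚ.*-zeroʳ (if c then y else 0ℚ))

  +-*-zeroʳ : ∀ x y → x + y * 0ℚ ≡ x
  +-*-zeroʳ x y = trans (cong (x +_) (ℚ.*-zeroʳ y)) (ℚ.+-identityʳ x)

  *-zeroʳ-+ : ∀ x y → x * 0ℚ + y ≡ y
  *-zeroʳ-+ x y = trans (cong (_+ y) (ℚ.*-zeroʳ x)) (ℚ.+-identityˡ y)

  +-*-zeroˡ : ∀ x y → x + 0ℚ * y ≡ x
  +-*-zeroˡ x y = trans (cong (x +_) (ℚ.*-zeroˡ y)) (ℚ.+-identityʳ x)

  ^-+ : ∀ θ m n → θ ^ (m ℕ.+ n) ≡ θ ^ m * θ ^ n
  ^-+ θ zero n = sym (ℚ.*-identityˡ _)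
  ^-+ θ (suc m) n rewrite ^-+ θ m n = sym (ℚ.*-assoc θ (θ ^ m) (θ ^ n))

  ^-* : ∀ θ m n → θ ^ (m ℕ.* n) ≡ (θ ^ n) ^ m
  ^-* θ zero n = refl
  ^-* θ (suc m) n = trans (^-+ θ n (m ℕ.* n)) (cong (θ ^ n *_) (^-* θ m n))

  -- Finite sums

  Σ : List A → (A → ℚ) → ℚ
  Σ xs f = sumℚ (map f xs)

  Σ-++ : (xs ys : List A) (f : A → ℚ) → Σ (xs ++ ys) f ≡ Σ xs f + Σ ys f
  Σ-++ [] ys f = sym (ℚ.+-identityˡ _)
  Σ-++ (x ∷ xs) ys f rewrite Σ-++ xs ys f = sym (ℚ.+-assoc (f x) _ _)

  Σ-concatMap : (g : A → List B) (xs : List A) (f : B → ℚ) →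
    Σ (concatMap g xs) f ≡ Σ xs (λ x → Σ (g x) f)
  Σ-concatMap g [] f = refl
  Σ-concatMap g (x ∷ xs) f = trans (Σ-++ (g x) (concatMap g xs) f) (cong (Σ (g x) f +_) (Σ-concatMap g xs f))

  Σ-map : (h : A → B) (xs : List A) (f : B → ℚ) → Σ (map h xs) f ≡ Σ xs (f ∘ h)
  Σ-map h [] f = refl
  Σ-map h (x ∷ xs) f = cong (f (h x) +_) (Σ-map h xs f)

  Σ-cong : (xs : List A) {f g : A → ℚ} → f ≗ g → Σ xs f ≡ Σ xs g
  Σ-cong [] f≗g = refl
  Σ-cong (x ∷ xs) f≗g = cong₂ _+_ (f≗g x) (Σ-cong xs f≗g)

  Σ-cong-All : {P : A → Set} (xs : List A) {f g : A → ℚ} → All P xs → (∀ x → P x → f x ≡ g x) →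
    Σ xs f ≡ Σ xs g
  Σ-cong-All [] [] f≡g = refl
  Σ-cong-All (x ∷ xs) (px ∷ pxs) f≡g = cong₂ _+_ (f≡g x px) (Σ-cong-All xs pxs f≡g)

  Σ-+ : (xs : List A) (f g : A → ℚ) → Σ xs (λ x → f x + g x) ≡ Σ xs f + Σ xs g
  Σ-+ [] f g = refl
  Σ-+ (x ∷ xs) f g rewrite Σ-+ xs f g = ℚ+.interchange (f x) (g x) (Σ xs f) (Σ xs g)

  Σ-*ˡ : (xs : List A) (c : ℚ) (f : A → ℚ) → Σ xs (λ x → c * f x) ≡ c * Σ xs f
  Σ-*ˡ [] c f = sym (ℚ.*-zeroʳ c)
  Σ-*ˡ (x ∷ xs) c f rewrite Σ-*ˡ xs c f = sym (ℚ.*-distribˡ-+ c (f x) (Σ xs f))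

  Σ-*ʳ : (xs : List A) (f : A → ℚ) (c : ℚ) → Σ xs (λ x → f x * c) ≡ Σ xs f * c
  Σ-*ʳ xs f c = begin
    Σ xs (λ x → f x * c) ≡⟨ Σ-cong xs (λ x → ℚ.*-comm (f x) c) ⟩
    Σ xs (λ x → c * f x) ≡⟨ Σ-*ˡ xs c f ⟩
    c * Σ xs f           ≡⟨ ℚ.*-comm c (Σ xs f) ⟩
    Σ xs f * c           ∎

  Σ-zero : (xs : List A) → Σ xs (λ _ → 0ℚ) ≡ 0ℚ
  Σ-zero [] = refl
  Σ-zero (x ∷ xs) rewrite Σ-zero xs = refl

  Σ-comm : (xs : List A) (ys : List B) (f : A → B → ℚ) →
    Σ xs (λ x → Σ ys (f x)) ≡ Σ ys (λ y → Σ xs (λ x → f x y))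
  Σ-comm [] ys f = sym (Σ-zero ys)
  Σ-comm (x ∷ xs) ys f rewrite Σ-comm xs ys f = sym (Σ-+ ys (f x) (λ y → Σ xs (λ x → f x y)))

  Σ-filter : (p : A → Bool) (xs : List A) (f : A → ℚ) →
    Σ (filter (T? ∘ p) xs) f ≡ Σ xs (λ x → if p x then f x else 0ℚ)
  Σ-filter p [] f = refl
  Σ-filter p (x ∷ xs) f with p x
  ... | true = cong (f x +_) (Σ-filter p xs f)
  ... | false = trans (Σ-filter p xs f) (sym (ℚ.+-identityˡ _))

  -- Words and permutations

  Σ-words-∷ : (as : List ℕ) (m : ℕ) (f : List ℕ → ℚ) →
    Σ (words as (suc m)) f ≡ Σ as (λ b → Σ (words as m) (λ w → f (b ∷ w)))
  Σ-words-∷ as m f = trans (Σ-concatMap (λ a → map (a ∷_) (words as m)) as f)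
    (Σ-cong as (λ b → Σ-map (b ∷_) (words as m) f))

  Σ-words-∷ʳ : (as : List ℕ) (m : ℕ) (f : List ℕ → ℚ) →
    Σ (words as (suc m)) f ≡ Σ (words as m) (λ w → Σ as (λ a → f (w ∷ʳ a)))
  Σ-words-∷ʳ as zero f = begin
    Σ (words as 1) f                     ≡⟨ Σ-words-∷ as 0 f ⟩
    Σ as (λ b → f (b ∷ []) + 0ℚ)         ≡⟨ Σ-cong as (λ b → ℚ.+-identityʳ (f (b ∷ []))) ⟩
    Σ as (λ b → f (b ∷ []))              ≡⟨ ℚ.+-identityʳ _ ⟨
    Σ (words as 0) (λ w → Σ as (λ a → f (w ∷ʳ a))) ∎
  Σ-words-∷ʳ as (suc m) f = begin
    Σ (words as (suc (suc m))) f
      ≡⟨ Σ-words-∷ as (suc m) f ⟩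
    Σ as (λ b → Σ (words as (suc m)) (λ w → f (b ∷ w)))
      ≡⟨ Σ-cong as (λ b → Σ-words-∷ʳ as m (λ w → f (b ∷ w))) ⟩
    Σ as (λ b → Σ (words as m) (λ w → Σ as (λ a → f (b ∷ w ∷ʳ a))))
      ≡⟨ Σ-words-∷ as m (λ w → Σ as (λ a → f (w ∷ʳ a))) ⟨
    Σ (words as (suc m)) (λ w → Σ as (λ a → f (w ∷ʳ a))) ∎

  Σ-words-map : (φ : ℕ → ℕ) (as : List ℕ) (m : ℕ) (f : List ℕ → ℚ) →
    Σ (words (map φ as) m) f ≡ Σ (words as m) (f ∘ map φ)
  Σ-words-map φ as zero f = refl
  Σ-words-map φ as (suc m) f = begin
    Σ (words (map φ as) (suc m)) f
      ≡⟨ Σ-words-∷ (map φ as) m f ⟩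
    Σ (map φ as) (λ b → Σ (words (map φ as) m) (λ w → f (b ∷ w)))
      ≡⟨ Σ-map φ as _ ⟩
    Σ as (λ b → Σ (words (map φ as) m) (λ w → f (φ b ∷ w)))
      ≡⟨ Σ-cong as (λ b → Σ-words-map φ as m (λ w → f (φ b ∷ w))) ⟩
    Σ as (λ b → Σ (words as m) (λ w → f (map φ (b ∷ w))))
      ≡⟨ Σ-words-∷ as m (f ∘ map φ) ⟨
    Σ (words as (suc m)) (f ∘ map φ) ∎

  Σ-words-cong-All : (P : ℕ → Set) (as : List ℕ) → All P as → (m : ℕ) {f g : List ℕ → ℚ} →
    (∀ w → All P w → length w ≡ m → f w ≡ g w) → Σ (words as m) f ≡ Σ (words as m) g
  Σ-words-cong-All P as pas zero f≡g = cong (_+ 0ℚ) (f≡g [] [] refl)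
  Σ-words-cong-All P as pas (suc m) {f} {g} f≡g =
    trans (Σ-words-∷ as m f) (trans (Σ-cong-All as pas step) (sym (Σ-words-∷ as m g)))
    where
    step : ∀ b → P b → Σ (words as m) (λ w → f (b ∷ w)) ≡ Σ (words as m) (λ w → g (b ∷ w))
    step b pb = Σ-words-cong-All P as pas m (λ w pw lw → f≡g (b ∷ w) (pb ∷ pw) (cong suc lw))

  remove : ℕ → List ℕ → List ℕ
  remove a [] = []
  remove a (x ∷ xs) = if a ≡ᵇ x then remove a xs else x ∷ remove a xs

  Σ-remove : (a : ℕ) (as : List ℕ) (f : ℕ → ℚ) →
    Σ (remove a as) f ≡ Σ as (λ b → if a ≡ᵇ b then 0ℚ else f b)
  Σ-remove a [] f = refl
  Σ-remove a (x ∷ as) f with a ≡ᵇ x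
  ... | true = trans (Σ-remove a as f) (sym (ℚ.+-identityˡ _))
  ... | false = cong (f x +_) (Σ-remove a as f)

  Σ-words-avoiding : (a : ℕ) (as : List ℕ) (m : ℕ) (f : List ℕ → ℚ) →
    Σ (words as m) (λ w → if memb a w then 0ℚ else f w) ≡ Σ (words (remove a as) m) f
  Σ-words-avoiding a as zero f = refl
  Σ-words-avoiding a as (suc m) f = begin
    Σ (words as (suc m)) (λ w → if memb a w then 0ℚ else f w)
      ≡⟨ Σ-words-∷ as m _ ⟩
    Σ as (λ b → Σ (words as m) (λ w → if memb a (b ∷ w) then 0ℚ else f (b ∷ w)))
      ≡⟨ Σ-cong as first-letter ⟩
    Σ as (λ b → if a ≡ᵇ b then 0ℚ else Σ (words (remove a as) m) (λ w → f (b ∷ w)))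
      ≡⟨ Σ-remove a as _ ⟨
    Σ (remove a as) (λ b → Σ (words (remove a as) m) (λ w → f (b ∷ w)))
      ≡⟨ Σ-words-∷ (remove a as) m f ⟨
    Σ (words (remove a as) (suc m)) f ∎
    where
    first-letter : ∀ b → Σ (words as m) (λ w → if memb a (b ∷ w) then 0ℚ else f (b ∷ w))
                       ≡ (if a ≡ᵇ b then 0ℚ else Σ (words (remove a as) m) (λ w → f (b ∷ w)))
    first-letter b with a ≡ᵇ b
    ... | true = Σ-zero (words as m)
    ... | false = Σ-words-avoiding a as m (λ w → f (b ∷ w))

  range : ℕ → ℕ → List ℕ
  range i zero = []
  range i (suc m) = i ∷ range (suc i) m

  map-suc-applyUpTo : ∀ m (f : ℕ → ℕ) i → (∀ j → f j ≡ i ℕ.+ j) → map suc (applyUpTo f m) ≡ range (suc i) m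
  map-suc-applyUpTo zero f i f≗i+ = refl
  map-suc-applyUpTo (suc m) f i f≗i+ = cong₂ _∷_ (cong suc (trans (f≗i+ 0) (ℕ.+-identityʳ i)))
    (map-suc-applyUpTo m (f ∘ suc) (suc i) (λ j → trans (f≗i+ (suc j)) (ℕ.+-suc i j)))

  map-suc-upTo : ∀ m → map suc (upTo m) ≡ range 1 m
  map-suc-upTo m = map-suc-applyUpTo m id 0 (λ _ → refl)

  range-bounds : ∀ i m → All (λ x → i ≤ x × x < i ℕ.+ m) (range i m)
  range-bounds i zero = []
  range-bounds i (suc m) = (ℕ.≤-refl , ℕ.m<m+n i (s≤s z≤n))
    ∷ All.map (λ {x} (i<x , x<i+m) → ℕ.<⇒≤ i<x , subst (x <_) (sym (ℕ.+-suc i m)) x<i+m) (range-bounds (suc i) m)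

  punchIn : ℕ → ℕ → ℕ
  punchIn a z = if z <ᵇ a then z else suc z

  punchIn-< : ∀ {a z} → z < a → punchIn a z ≡ z
  punchIn-< z<a rewrite <⇒<ᵇ≡true z<a = refl

  punchIn-≥ : ∀ {a z} → a ≤ z → punchIn a z ≡ suc z
  punchIn-≥ a≤z rewrite ≮⇒<ᵇ≡false (ℕ.≤⇒≯ a≤z) = refl

  punchIn-strictMono : ∀ a {x y} → x < y → punchIn a x < punchIn a y
  punchIn-strictMono a {x} {y} x<y with x ℕ.<? a | y ℕ.<? a
  ... | yes x<a | yes y<a rewrite punchIn-< x<a | punchIn-< y<a = x<y
  ... | yes x<a | no y≮a rewrite punchIn-< x<a | punchIn-≥ (ℕ.≮⇒≥ y≮a) = ℕ.m<n⇒m<1+n x<y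
  ... | no x≮a | yes y<a = ⊥-elim (ℕ.<-asym y<a (ℕ.≤-<-trans (ℕ.≮⇒≥ x≮a) x<y))
  ... | no x≮a | no y≮a rewrite punchIn-≥ (ℕ.≮⇒≥ x≮a) | punchIn-≥ (ℕ.≮⇒≥ y≮a) = s≤s x<y

  <ᵇ-preserved : ∀ {φ} → φ Preserves _<_ ⟶ _<_ → ∀ x y → (φ x <ᵇ φ y) ≡ (x <ᵇ y)
  <ᵇ-preserved {φ} mono x y with ℕ.<-cmp x y
  ... | tri< x<y _ _ = trans (<⇒<ᵇ≡true (mono x<y)) (sym (<⇒<ᵇ≡true x<y))
  ... | tri≈ _ refl _ = trans (≮⇒<ᵇ≡false (ℕ.n≮n (φ x))) (sym (≮⇒<ᵇ≡false (ℕ.n≮n x)))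
  ... | tri> _ _ y<x = trans (≮⇒<ᵇ≡false (ℕ.<⇒≯ (mono y<x))) (sym (≮⇒<ᵇ≡false (ℕ.<⇒≯ y<x)))

  ≡ᵇ-preserved : ∀ {φ} → φ Preserves _<_ ⟶ _<_ → ∀ x y → (φ x ≡ᵇ φ y) ≡ (x ≡ᵇ y)
  ≡ᵇ-preserved {φ} mono x y with ℕ.<-cmp x y
  ... | tri< x<y _ _ = trans (≢⇒≡ᵇ≡false (ℕ.<⇒≢ (mono x<y))) (sym (≢⇒≡ᵇ≡false (ℕ.<⇒≢ x<y)))
  ... | tri≈ _ refl _ = trans (≡ᵇ-refl (φ x)) (sym (≡ᵇ-refl x))
  ... | tri> _ _ y<x = trans (≢⇒≡ᵇ≡false (ℕ.>⇒≢ (mono y<x))) (sym (≢⇒≡ᵇ≡false (ℕ.>⇒≢ y<x)))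

  memb-map : ∀ {φ} → φ Preserves _<_ ⟶ _<_ → ∀ x v → memb (φ x) (map φ v) ≡ memb x v
  memb-map mono x [] = refl
  memb-map mono x (y ∷ v) = cong₂ _∨_ (≡ᵇ-preserved mono x y) (memb-map mono x v)

  distinct-map : ∀ {φ} → φ Preserves _<_ ⟶ _<_ → ∀ v → distinct (map φ v) ≡ distinct v
  distinct-map mono [] = refl
  distinct-map mono (x ∷ v) = cong₂ (λ m d → not m ∧ d) (memb-map mono x v) (distinct-map mono v)

  memb-∷ʳ : ∀ x w a → memb x (w ∷ʳ a) ≡ memb x w ∨ (x ≡ᵇ a)
  memb-∷ʳ x [] a = ∨-identityʳ (x ≡ᵇ a)
  memb-∷ʳ x (y ∷ w) a rewrite memb-∷ʳ x w a = sym (∨-assoc (x ≡ᵇ y) (memb x w) (x ≡ᵇ a))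

  distinct-∷ʳ : ∀ w a → distinct (w ∷ʳ a) ≡ distinct w ∧ not (memb a w)
  distinct-∷ʳ [] a = refl
  distinct-∷ʳ (x ∷ w) a rewrite memb-∷ʳ x w a | distinct-∷ʳ w a | ≡ᵇ-sym x a =
    reassociate (memb x w) (a ≡ᵇ x) (distinct w) (memb a w)
    where
    reassociate : ∀ m e d m′ → not (m ∨ e) ∧ (d ∧ not m′) ≡ (not m ∧ d) ∧ not (e ∨ m′)
    reassociate true _ _ _ = refl
    reassociate false true false _ = refl
    reassociate false true true _ = refl
    reassociate false false false _ = refl
    reassociate false false true _ = refl

  remove-range-below : ∀ a j m → a < j → remove a (range j m) ≡ range j m
  remove-range-below a j zero a<j = refl
  remove-range-below a j (suc m) a<j rewrite ≢⇒≡ᵇ≡false (ℕ.<⇒≢ a<j) =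
    cong (j ∷_) (remove-range-below a (suc j) m (ℕ.m<n⇒m<1+n a<j))

  map-punchIn-range-above : ∀ a j m → a ≤ j → map (punchIn a) (range j m) ≡ range (suc j) m
  map-punchIn-range-above a j zero a≤j = refl
  map-punchIn-range-above a j (suc m) a≤j =
    cong₂ _∷_ (punchIn-≥ a≤j) (map-punchIn-range-above a (suc j) m (ℕ.m≤n⇒m≤1+n a≤j))

  remove-range : ∀ m i a → i ≤ a → a ≤ i ℕ.+ m → remove a (range i (suc m)) ≡ map (punchIn a) (range i m)
  remove-range m i a i≤a a≤i+m with a ℕ.≟ i
  ... | yes refl rewrite ≡ᵇ-refl a =
    trans (remove-range-below a (suc a) m ℕ.≤-refl) (sym (map-punchIn-range-above a a m ℕ.≤-refl))
  remove-range zero i a i≤a a≤i+0 | no a≢i =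
    ⊥-elim (a≢i (ℕ.≤-antisym (subst (a ≤_) (ℕ.+-identityʳ i) a≤i+0) i≤a))
  remove-range (suc m) i a i≤a a≤i+1+m | no a≢i rewrite ≢⇒≡ᵇ≡false a≢i =
    cong₂ _∷_ (sym (punchIn-< i<a)) (remove-range m (suc i) a i<a (subst (a ≤_) (ℕ.+-suc i m) a≤i+1+m))
    where
    i<a : i < a
    i<a = ℕ.≤∧≢⇒< i≤a (a≢i ∘ sym)

  ΣSym : ℕ → (List ℕ → ℚ) → ℚ
  ΣSym n F = Σ (words (range 1 n) n) (λ w → if distinct w then F w else 0ℚ)

  Σ-Sym : ∀ n (F : List ℕ → ℚ) → Σ (Sym n) F ≡ ΣSym n F
  Σ-Sym n F = trans (Σ-filter distinct (words (map suc (upTo n)) n) F)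
    (cong (λ as → Σ (words as n) (λ w → if distinct w then F w else 0ℚ)) (map-suc-upTo n))

  -- A permutation of 1 … n+1 ending in a is (the a-punched image of) a permutation of 1 … n followed by a.
  extend : ℕ → List ℕ → List ℕ
  extend a v = map (punchIn a) v ∷ʳ a

  ΣSym-suc : ∀ n F → ΣSym (suc n) F ≡ Σ (range 1 (suc n)) (λ a → ΣSym n (F ∘ extend a))
  ΣSym-suc n F = begin
    ΣSym (suc n) F
      ≡⟨ Σ-words-∷ʳ as n G ⟩
    Σ (words as n) (λ w → Σ as (λ a → G (w ∷ʳ a)))
      ≡⟨ Σ-comm (words as n) as (λ w a → G (w ∷ʳ a)) ⟩
    Σ as (λ a → Σ (words as n) (λ w → G (w ∷ʳ a)))
      ≡⟨ Σ-cong-All as (range-bounds 1 (suc n)) (λ a (1≤a , a≤1+n) → last-letter a 1≤a (ℕ.≤-pred a≤1+n)) ⟩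
    Σ as (λ a → ΣSym n (F ∘ extend a)) ∎
    where
    as = range 1 (suc n)
    G : List ℕ → ℚ
    G w = if distinct w then F w else 0ℚ
    split : ∀ d m (x : ℚ) → (if d ∧ not m then x else 0ℚ) ≡ (if m then 0ℚ else (if d then x else 0ℚ))
    split true true x = refl
    split true false x = refl
    split false true x = refl
    split false false x = refl
    last-letter : ∀ a → 1 ≤ a → a ≤ suc n → Σ (words as n) (λ w → G (w ∷ʳ a)) ≡ ΣSym n (F ∘ extend a)
    last-letter a 1≤a a≤1+n = begin
      Σ (words as n) (λ w → G (w ∷ʳ a))
        ≡⟨ Σ-cong (words as n) (λ w → trans (cong (λ d → if d then F (w ∷ʳ a) else 0ℚ) (distinct-∷ʳ w a))
                                              (split (distinct w) (memb a w) (F (w ∷ʳ a)))) ⟩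
      Σ (words as n) (λ w → if memb a w then 0ℚ else (if distinct w then F (w ∷ʳ a) else 0ℚ))
        ≡⟨ Σ-words-avoiding a as n _ ⟩
      Σ (words (remove a as) n) (λ w → if distinct w then F (w ∷ʳ a) else 0ℚ)
        ≡⟨ cong (λ bs → Σ (words bs n) (λ w → if distinct w then F (w ∷ʳ a) else 0ℚ))
                (remove-range n 1 a 1≤a a≤1+n) ⟩
      Σ (words (map (punchIn a) (range 1 n)) n) (λ w → if distinct w then F (w ∷ʳ a) else 0ℚ)
        ≡⟨ Σ-words-map (punchIn a) (range 1 n) n _ ⟩
      Σ (words (range 1 n) n) (λ v → if distinct (map (punchIn a) v) then F (extend a v) else 0ℚ)
        ≡⟨ Σ-cong (words (range 1 n) n) (λ v → cong (λ d → if d then F (extend a v) else 0ℚ)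
                                                     (distinct-map (punchIn-strictMono a) v)) ⟩
      ΣSym n (F ∘ extend a) ∎

  -- Counting and inversions

  count : (ℕ → Bool) → List ℕ → ℕ
  count p [] = 0
  count p (x ∷ xs) = if p x then suc (count p xs) else count p xs

  length-filter : ∀ p xs → length (filter (T? ∘ p) xs) ≡ count p xs
  length-filter p [] = refl
  length-filter p (x ∷ xs) with p x
  ... | true = cong suc (length-filter p xs)
  ... | false = length-filter p xs

  count-map : ∀ p (φ : ℕ → ℕ) xs → count p (map φ xs) ≡ count (p ∘ φ) xs
  count-map p φ [] = refl
  count-map p φ (x ∷ xs) rewrite count-map p φ xs = refl

  count-cong : ∀ {p q} → p ≗ q → ∀ xs → count p xs ≡ count q xs
  count-cong p≗q [] = refl
  count-cong p≗q (x ∷ xs) rewrite p≗q x | count-cong p≗q xs = refl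

  count-∷ʳ : ∀ p xs a → count p (xs ∷ʳ a) ≡ count p xs ℕ.+ (if p a then 1 else 0)
  count-∷ʳ p [] a with p a
  ... | true = refl
  ... | false = refl
  count-∷ʳ p (x ∷ xs) a rewrite count-∷ʳ p xs a with p x
  ... | true = refl
  ... | false = refl

  count-reverseAcc : ∀ p acc xs → count p (reverseAcc acc xs) ≡ count p xs ℕ.+ count p acc
  count-reverseAcc p acc [] = refl
  count-reverseAcc p acc (x ∷ xs) rewrite count-reverseAcc p (x ∷ acc) xs with p x
  ... | true = ℕ.+-suc (count p xs) (count p acc)
  ... | false = refl

  count-true : ∀ xs → count (λ _ → true) xs ≡ length xs
  count-true [] = refl
  count-true (x ∷ xs) = cong suc (count-true xs)

  inv-∷ʳ : ∀ xs a → inv (xs ∷ʳ a) ≡ inv xs ℕ.+ count (a <ᵇ_) xs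
  inv-∷ʳ [] a = refl
  inv-∷ʳ (x ∷ xs) a rewrite length-filter (_<ᵇ x) (xs ∷ʳ a) | length-filter (_<ᵇ x) xs | inv-∷ʳ xs a
    | count-∷ʳ (_<ᵇ x) xs a with a <ᵇ x
  ... | true = ℕ+.interchange (count (_<ᵇ x) xs) 1 (inv xs) (count (a <ᵇ_) xs)
  ... | false = ℕ+.interchange (count (_<ᵇ x) xs) 0 (inv xs) (count (a <ᵇ_) xs)

  inv-map : ∀ {φ} → φ Preserves _<_ ⟶ _<_ → ∀ v → inv (map φ v) ≡ inv v
  inv-map {φ} mono [] = refl
  inv-map {φ} mono (x ∷ v) rewrite length-filter (_<ᵇ φ x) (map φ v) | length-filter (_<ᵇ x) v
    | count-map (_<ᵇ φ x) φ v | count-cong (λ y → <ᵇ-preserved mono y x) v | inv-map mono v = refl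

  remove-∉ : ∀ a xs → memb a xs ≡ false → remove a xs ≡ xs
  remove-∉ a [] _ = refl
  remove-∉ a (x ∷ xs) a∉ with a ≡ᵇ x
  remove-∉ a (x ∷ xs) () | true
  ... | false = cong (x ∷_) (remove-∉ a xs a∉)

  ∈-remove⁻ : ∀ y a xs → T (memb y (remove a xs)) → T (memb y xs)
  ∈-remove⁻ y a [] y∈ = y∈
  ∈-remove⁻ y a (x ∷ xs) y∈ with a ≡ᵇ x
  ... | true with y ≡ᵇ x
  ...   | true = _
  ...   | false = ∈-remove⁻ y a xs y∈
  ∈-remove⁻ y a (x ∷ xs) y∈ | false with y ≡ᵇ x
  ...   | true = _
  ...   | false = ∈-remove⁻ y a xs y∈

  ∈-remove⁺ : ∀ y a xs → T (memb y xs) → a ≢ y → T (memb y (remove a xs))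
  ∈-remove⁺ y a (x ∷ xs) y∈ a≢y with a ≡ᵇ x in a≡x
  ... | true with y ≡ᵇ x in y≡x
  ...   | true = ⊥-elim (a≢y (trans (≡ᵇ≡true⇒≡ a x a≡x) (sym (≡ᵇ≡true⇒≡ y x y≡x))))
  ...   | false = ∈-remove⁺ y a xs y∈ a≢y
  ∈-remove⁺ y a (x ∷ xs) y∈ a≢y | false with y ≡ᵇ x
  ...   | true = _
  ...   | false = ∈-remove⁺ y a xs y∈ a≢y

  distinct-remove : ∀ a xs → T (distinct xs) → T (distinct (remove a xs))
  distinct-remove a [] _ = _
  distinct-remove a (x ∷ xs) d with memb x xs in x∈ | distinct xs in dxs
  distinct-remove a (x ∷ xs) () | true | _
  distinct-remove a (x ∷ xs) () | false | false
  ... | false | true with a ≡ᵇ x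
  ...   | true = distinct-remove a xs (≡true⇒T dxs)
  ...   | false with memb x (remove a xs) in x∈′
  ...     | true = ⊥-elim (subst T x∈ (∈-remove⁻ x a xs (≡true⇒T x∈′)))
  ...     | false = distinct-remove a xs (≡true⇒T dxs)

  count-remove : ∀ p a xs → T (distinct xs) → T (memb a xs) →
    count p xs ≡ (if p a then suc (count p (remove a xs)) else count p (remove a xs))
  count-remove p a (x ∷ xs) d a∈ with memb x xs in x∈ | distinct xs in dxs
  count-remove p a (x ∷ xs) () a∈ | true | _
  count-remove p a (x ∷ xs) () a∈ | false | false
  ... | false | true with a ≡ᵇ x in a≡x
  ...   | true rewrite ≡ᵇ≡true⇒≡ a x a≡x | remove-∉ x xs x∈ = refl
  ...   | false with p a | p x | count-remove p a xs (≡true⇒T dxs) a∈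
  ...     | true | true | ih rewrite ih = refl
  ...     | true | false | ih = ih
  ...     | false | true | ih rewrite ih = refl
  ...     | false | false | ih = ih

  ∉⇒All≢ : ∀ x xs → memb x xs ≡ false → All (x ≢_) xs
  ∉⇒All≢ x [] _ = []
  ∉⇒All≢ x (y ∷ xs) x∉ with x ≡ᵇ y in x≡y
  ∉⇒All≢ x (y ∷ xs) () | true
  ... | false = ≡ᵇ≡false⇒≢ x y x≡y ∷ ∉⇒All≢ x xs x∉

  count-permutation : ∀ p xs ys → T (distinct xs) → T (distinct ys) → All (λ x → T (memb x ys)) xs →
    length xs ≡ length ys → count p xs ≡ count p ys
  count-permutation p [] [] _ _ _ _ = refl
  count-permutation p (x ∷ xs) ys d dys (x∈ys ∷ xs⊆ys) |xs|≡|ys| with memb x xs in x∈ | distinct xs in dxs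
  count-permutation p (x ∷ xs) ys () dys _ _ | true | _
  count-permutation p (x ∷ xs) ys () dys _ _ | false | false
  ... | false | true = trans (head (count-permutation p xs (remove x ys) (≡true⇒T dxs) (distinct-remove x ys dys)
                                       xs⊆ys∖x |xs|≡|ys∖x|))
                             (sym (count-remove p x ys dys x∈ys))
    where
    xs⊆ys∖x : All (λ y → T (memb y (remove x ys))) xs
    xs⊆ys∖x = All.zipWith (λ {y} (y∈ys , x≢y) → ∈-remove⁺ y x ys y∈ys x≢y) (xs⊆ys , ∉⇒All≢ x xs x∈)
    |xs|≡|ys∖x| : length xs ≡ length (remove x ys)
    |xs|≡|ys∖x| = ℕ.suc-injective (begin
      suc (length xs)                   ≡⟨ |xs|≡|ys| ⟩
      length ys                         ≡⟨ count-true ys ⟨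
      count (λ _ → true) ys             ≡⟨ count-remove (λ _ → true) x ys dys x∈ys ⟩
      suc (count (λ _ → true) (remove x ys)) ≡⟨ cong suc (count-true (remove x ys)) ⟩
      suc (length (remove x ys))        ∎)
    head : count p xs ≡ count p (remove x ys) →
      count p (x ∷ xs) ≡ (if p x then suc (count p (remove x ys)) else count p (remove x ys))
    head ih with p x
    ... | true = cong suc ih
    ... | false = ih

  ∈-range⇒bounds : ∀ x i m → T (memb x (range i m)) → i ≤ x × x < i ℕ.+ m
  ∈-range⇒bounds x i (suc m) x∈ with x ≡ᵇ i in x≡i
  ... | true rewrite ≡ᵇ≡true⇒≡ x i x≡i = ℕ.≤-refl , ℕ.m<m+n i (s≤s z≤n)
  ... | false with ∈-range⇒bounds x (suc i) m x∈
  ...   | i<x , x<1+i+m = ℕ.<⇒≤ i<x , subst (x <_) (sym (ℕ.+-suc i m)) x<1+i+m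

  ∈-self : ∀ xs → All (λ x → T (memb x xs)) xs
  ∈-self [] = []
  ∈-self (x ∷ xs) = here ∷ All.map (λ {y} → there y) (∈-self xs)
    where
    here : T (memb x (x ∷ xs))
    here rewrite ≡ᵇ-refl x = _
    there : ∀ y → T (memb y xs) → T (memb y (x ∷ xs))
    there y y∈ with y ≡ᵇ x
    ... | true = _
    ... | false = y∈

  distinct-range : ∀ i m → T (distinct (range i m))
  distinct-range i zero = _
  distinct-range i (suc m) with memb i (range (suc i) m) in i∈
  ... | true = ⊥-elim (ℕ.n≮n i (proj₁ (∈-range⇒bounds i (suc i) m (≡true⇒T i∈))))
  ... | false = distinct-range (suc i) m

  length-range : ∀ i m → length (range i m) ≡ m
  length-range i zero = refl
  length-range i (suc m) = cong suc (length-range (suc i) m)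

  count-≥-range-above : ∀ a i m → a ≤ i → count (a ≤ᵇ_) (range i m) ≡ m
  count-≥-range-above a i zero a≤i = refl
  count-≥-range-above a i (suc m) a≤i rewrite T⇒≡true (ℕ.≤⇒≤ᵇ a≤i) =
    cong suc (count-≥-range-above a (suc i) m (ℕ.m≤n⇒m≤1+n a≤i))

  count-≥-range : ∀ m i a → i ≤ a → a ≤ i ℕ.+ m → count (a ≤ᵇ_) (range i m) ≡ i ℕ.+ m ∸ a
  count-≥-range m i a i≤a a≤i+m with a ℕ.≟ i
  ... | yes refl = trans (count-≥-range-above a a m ℕ.≤-refl) (sym (ℕ.m+n∸m≡n a m))
  count-≥-range zero i a i≤a a≤i+0 | no a≢i =
    ⊥-elim (a≢i (ℕ.≤-antisym (subst (a ≤_) (ℕ.+-identityʳ i) a≤i+0) i≤a))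
  count-≥-range (suc m) i a i≤a a≤i+1+m | no a≢i
    rewrite ¬T⇒≡false (ℕ.<⇒≱ (ℕ.≤∧≢⇒< i≤a (a≢i ∘ sym)) ∘ ℕ.≤ᵇ⇒≤ a i) =
    trans (count-≥-range m (suc i) a i<a (subst (a ≤_) (ℕ.+-suc i m) a≤i+1+m)) (cong (_∸ a) (sym (ℕ.+-suc i m)))
    where
    i<a : i < a
    i<a = ℕ.≤∧≢⇒< i≤a (a≢i ∘ sym)

  <ᵇ-punchIn : ∀ a z → (a <ᵇ punchIn a z) ≡ (a ≤ᵇ z)
  <ᵇ-punchIn a z with z ℕ.<? a
  ... | yes z<a rewrite punchIn-< z<a =
    trans (≮⇒<ᵇ≡false (ℕ.<-asym z<a)) (sym (¬T⇒≡false (ℕ.<⇒≱ z<a ∘ ℕ.≤ᵇ⇒≤ a z)))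
  ... | no z≮a rewrite punchIn-≥ (ℕ.≮⇒≥ z≮a) =
    trans (<⇒<ᵇ≡true (s≤s (ℕ.≮⇒≥ z≮a))) (sym (T⇒≡true (ℕ.≤⇒≤ᵇ (ℕ.≮⇒≥ z≮a))))

  record IsPerm (n : ℕ) (v : List ℕ) : Set where
    field
      ⊆range : All (λ x → T (memb x (range 1 n))) v
      unique : T (distinct v)
      length≡ : length v ≡ n

  IsPerm⇒All≤ : ∀ {n v} → IsPerm n v → All (_≤ n) v
  IsPerm⇒All≤ {n} v∈Sₙ =
    All.map (λ {x} x∈ → ℕ.≤-pred (proj₂ (∈-range⇒bounds x 1 n x∈))) (IsPerm.⊆range v∈Sₙ)

  count-above-punchIn : ∀ {n v} → IsPerm n v → ∀ a → 1 ≤ a → a ≤ suc n →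
    count (a <ᵇ_) (map (punchIn a) v) ≡ suc n ∸ a
  count-above-punchIn {n} {v} v∈Sₙ a 1≤a a≤1+n = begin
    count (a <ᵇ_) (map (punchIn a) v) ≡⟨ count-map (a <ᵇ_) (punchIn a) v ⟩
    count (λ z → a <ᵇ punchIn a z) v  ≡⟨ count-cong (<ᵇ-punchIn a) v ⟩
    count (a ≤ᵇ_) v                   ≡⟨ count-permutation (a ≤ᵇ_) v (range 1 n) unique (distinct-range 1 n) ⊆range
                                           (trans length≡ (sym (length-range 1 n))) ⟩
    count (a ≤ᵇ_) (range 1 n)         ≡⟨ count-≥-range n 1 a 1≤a a≤1+n ⟩
    suc n ∸ a                         ∎
    where open IsPerm v∈Sₙ

  inv-extend : ∀ {n v} → IsPerm n v → ∀ a → 1 ≤ a → a ≤ suc n → inv (extend a v) ≡ inv v ℕ.+ (suc n ∸ a)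
  inv-extend {n} {v} v∈Sₙ a 1≤a a≤1+n rewrite inv-∷ʳ (map (punchIn a) v) a
    | inv-map (punchIn-strictMono a) v | count-above-punchIn v∈Sₙ a 1≤a a≤1+n = refl

  -- The strategy on an extended permutation

  go-∷ : ∀ k x xs seen i → go k (x ∷ xs) seen i ≡
    (if (k ≤ᵇ i) ∧ (count (x <ᵇ_) seen ≡ᵇ 1) then just x else go k xs (x ∷ seen) (suc i))
  go-∷ k x xs seen i rewrite length-filter (x <ᵇ_) seen = refl

  go-map : ∀ k {φ} → φ Preserves _<_ ⟶ _<_ →
    ∀ v seen i → go k (map φ v) (map φ seen) i ≡ Maybe.map φ (go k v seen i)
  go-map k mono [] seen i = refl
  go-map k {φ} mono (x ∷ v) seen i rewrite go-∷ k (φ x) (map φ v) (map φ seen) i | go-∷ k x v seen i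
    | count-map (φ x <ᵇ_) φ seen | count-cong (<ᵇ-preserved mono x) seen
    with (k ≤ᵇ i) ∧ (count (x <ᵇ_) seen ≡ᵇ 1)
  ... | true = refl
  ... | false = go-map k mono v (x ∷ seen) (suc i)

  go-∷ʳ : ∀ k v a seen i → go k (v ∷ʳ a) seen i ≡
    go k v seen i <∣> (if (k ≤ᵇ i ℕ.+ length v) ∧ (count (a <ᵇ_) (reverseAcc seen v) ≡ᵇ 1) then just a else nothing)
  go-∷ʳ k [] a seen i rewrite go-∷ k a [] seen i | ℕ.+-identityʳ i = refl
  go-∷ʳ k (x ∷ v) a seen i rewrite go-∷ k x (v ∷ʳ a) seen i | go-∷ k x v seen i | ℕ.+-suc i (length v)
    with (k ≤ᵇ i) ∧ (count (x <ᵇ_) seen ≡ᵇ 1)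
  ... | true = refl
  ... | false = go-∷ʳ k v a (x ∷ seen) (suc i)

  -- A left-to-right second maximum has a larger value before it, so it is never the maximum.
  go-< : ∀ n k v seen i z → All (_≤ n) v → All (_≤ n) seen → go k v seen i ≡ just z → z < n
  go-< n k (x ∷ v) seen i z (x≤n ∷ v≤n) seen≤n found rewrite go-∷ k x v seen i
    with (k ≤ᵇ i) ∧ (count (x <ᵇ_) seen ≡ᵇ 1) in selected
  ... | true = subst (_< n) (just-injective found)
                 (below seen seen≤n (ℕ.≡ᵇ⇒≡ _ 1 (proj₂ (Equivalence.to T-∧ (≡true⇒T selected)))))
    where
    below : ∀ seen → All (_≤ n) seen → count (x <ᵇ_) seen ≡ 1 → x < n
    below (y ∷ seen) (y≤n ∷ seen≤n) one with x <ᵇ y in x<y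
    ... | true = ℕ.<-≤-trans (ℕ.<ᵇ⇒< x y (≡true⇒T x<y)) y≤n
    ... | false = below seen seen≤n one
  ... | false = go-< n k v (x ∷ seen) (suc i) z v≤n (x≤n ∷ seen≤n) found

  selectS2-extend : ∀ k {n v} → IsPerm n v → ∀ a → 1 ≤ a → a ≤ suc n →
    selectS2 k (extend a v) ≡
      Maybe.map (punchIn a) (selectS2 k v) <∣> (if (k ≤ᵇ n) ∧ (suc n ∸ a ≡ᵇ 1) then just a else nothing)
  selectS2-extend k {n} {v} v∈Sₙ a 1≤a a≤1+n
    rewrite go-∷ʳ k (map (punchIn a) v) a [] 0 | go-map k (punchIn-strictMono a) v [] 0
    | count-reverseAcc (a <ᵇ_) [] (map (punchIn a) v) | ℕ.+-identityʳ (count (a <ᵇ_) (map (punchIn a) v))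
    | count-above-punchIn v∈Sₙ a 1≤a a≤1+n | List.length-map (punchIn a) v | IsPerm.length≡ v∈Sₙ = refl

  weightT : ℚ → ℕ → List ℕ → ℚ
  weightT θ k π = if not (pickable k π) then θ ^ inv π else 0ℚ

  weightW : ℚ → ℕ → ℕ → List ℕ → ℚ
  weightW θ n k π = if winnable n k π then θ ^ inv π else 0ℚ

  T2≡ΣSym : ∀ θ n k → T2 θ n k ≡ ΣSym n (weightT θ k)
  T2≡ΣSym θ n k = trans (Σ-filter (λ π → not (pickable k π)) (Sym n) (λ π → θ ^ inv π)) (Σ-Sym n (weightT θ k))

  W2≡ΣSym : ∀ θ n k → W2 θ n k ≡ ΣSym n (weightW θ n k)
  W2≡ΣSym θ n k = trans (Σ-filter (winnable n k) (Sym n) (λ π → θ ^ inv π)) (Σ-Sym n (weightW θ n k))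

  pickable≡is-just : ∀ k π → pickable k π ≡ Maybe.is-just (selectS2 k π)
  pickable≡is-just k π with selectS2 k π
  ... | just _ = refl
  ... | nothing = refl

  winnable≡ : ∀ n k π → winnable n k π ≡ Maybe.maybe′ (_≡ᵇ n ∸ 1) false (selectS2 k π)
  winnable≡ n k π with selectS2 k π
  ... | just _ = refl
  ... | nothing = refl

  -- The last letter a of an extended permutation is exceeded by j = suc n ∸ a earlier values; it is a
  -- left-to-right second maximum iff j = 1, and selecting it is allowed iff k ≤ n.
  skipWeight : ℚ → Bool → ℕ → ℚ
  skipWeight θ allowed j = if allowed ∧ (j ≡ᵇ 1) then 0ℚ else θ ^ j

  keepWinWeight : ℚ → ℕ → ℚ
  keepWinWeight θ j = if 2 ≤ᵇ j then θ ^ j else 0ℚ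

  newWinWeight : ℚ → Bool → ℕ → ℚ
  newWinWeight θ allowed j = if allowed ∧ (j ≡ᵇ 1) then θ ^ j else 0ℚ

  weightT-extend : ∀ θ k {n v} → IsPerm n v → ∀ a → 1 ≤ a → a ≤ suc n →
    weightT θ k (extend a v) ≡ skipWeight θ (k ≤ᵇ n) (suc n ∸ a) * weightT θ k v
  weightT-extend θ k {n} {v} v∈Sₙ a 1≤a a≤1+n rewrite pickable≡is-just k (extend a v) | pickable≡is-just k v
    | selectS2-extend k v∈Sₙ a 1≤a a≤1+n | inv-extend v∈Sₙ a 1≤a a≤1+n with selectS2 k v
  ... | just _ = sym (ℚ.*-zeroʳ (skipWeight θ (k ≤ᵇ n) (suc n ∸ a)))
  ... | nothing with (k ≤ᵇ n) ∧ (suc n ∸ a ≡ᵇ 1)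
  ...   | true = sym (ℚ.*-zeroˡ (θ ^ inv v))
  ...   | false = trans (^-+ θ (inv v) (suc n ∸ a)) (ℚ.*-comm (θ ^ inv v) (θ ^ (suc n ∸ a)))

  -- The runner-up n of S (suc n) comes from the runner-up n ∸ 1 of S n exactly when a lies below it.
  punchIn-≡ᵇ-runnerUp : ∀ n a z → a ≤ suc n → z < n →
    (punchIn a z ≡ᵇ n) ≡ (z ≡ᵇ n ∸ 1) ∧ (2 ≤ᵇ suc n ∸ a)
  punchIn-≡ᵇ-runnerUp (suc m) a z a≤2+m z<1+m = T-cong forward backward
    where
    forward : T (punchIn a z ≡ᵇ suc m) → T ((z ≡ᵇ m) ∧ (2 ≤ᵇ suc (suc m) ∸ a))
    forward z′≡1+m with z ℕ.<? a
    ... | yes z<a rewrite punchIn-< z<a = ⊥-elim (ℕ.<-irrefl (ℕ.≡ᵇ⇒≡ z (suc m) z′≡1+m) z<1+m)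
    ... | no z≮a rewrite punchIn-≥ (ℕ.≮⇒≥ z≮a) with ℕ.≡ᵇ⇒≡ z m z′≡1+m
    ...   | refl =
      Equivalence.from T-∧ (ℕ.≡⇒≡ᵇ z z refl , ℕ.≤⇒≤ᵇ (ℕ.m+n≤o⇒m≤o∸n 2 (s≤s (s≤s (ℕ.≮⇒≥ z≮a)))))
    backward : T ((z ≡ᵇ m) ∧ (2 ≤ᵇ suc (suc m) ∸ a)) → T (punchIn a z ≡ᵇ suc m)
    backward z≡m∧2≤j with Equivalence.to T-∧ z≡m∧2≤j
    ... | z≡m , 2≤j with ℕ.≡ᵇ⇒≡ z m z≡m
    ...   | refl rewrite punchIn-≥ (ℕ.≤-pred (ℕ.≤-pred (ℕ.m≤o∸n⇒m+n≤o 2 a≤2+m (ℕ.≤ᵇ⇒≤ 2 _ 2≤j)))) =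
      ℕ.≡⇒≡ᵇ z z refl

  weightW-extend : ∀ θ k {n v} → IsPerm n v → ∀ a → 1 ≤ a → a ≤ suc n →
    weightW θ (suc n) k (extend a v) ≡
      keepWinWeight θ (suc n ∸ a) * weightW θ n k v + newWinWeight θ (k ≤ᵇ n) (suc n ∸ a) * weightT θ k v
  weightW-extend θ k {n} {v} v∈Sₙ a 1≤a a≤1+n rewrite winnable≡ (suc n) k (extend a v) | winnable≡ n k v
    | pickable≡is-just k v | selectS2-extend k v∈Sₙ a 1≤a a≤1+n | inv-extend v∈Sₙ a 1≤a a≤1+n
    | ^-+ θ (inv v) (suc n ∸ a) with selectS2 k v in selected
  ... | just z rewrite punchIn-≡ᵇ-runnerUp n a z a≤1+n (go-< n k v [] 0 z (IsPerm⇒All≤ v∈Sₙ) [] selected) =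
    trans (if-∧-* (z ≡ᵇ n ∸ 1) (2 ≤ᵇ suc n ∸ a) (θ ^ inv v) (θ ^ (suc n ∸ a)))
          (sym (+-*-zeroʳ (keepWinWeight θ (suc n ∸ a) * (if z ≡ᵇ n ∸ 1 then θ ^ inv v else 0ℚ))
                          (newWinWeight θ (k ≤ᵇ n) (suc n ∸ a))))
  ... | nothing = trans (last-letter-wins ((k ≤ᵇ n) ∧ (suc n ∸ a ≡ᵇ 1)) refl)
                        (sym (*-zeroʳ-+ (keepWinWeight θ (suc n ∸ a))
                                        (newWinWeight θ (k ≤ᵇ n) (suc n ∸ a) * θ ^ inv v)))
    where
    last-letter-wins : ∀ b → (k ≤ᵇ n) ∧ (suc n ∸ a ≡ᵇ 1) ≡ b →
      (if Maybe.maybe′ (_≡ᵇ n) false (if b then just a else nothing) then θ ^ inv v * θ ^ (suc n ∸ a) else 0ℚ)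
        ≡ newWinWeight θ (k ≤ᵇ n) (suc n ∸ a) * θ ^ inv v
    last-letter-wins true selectable rewrite selectable
      | T⇒≡true (ℕ.≡⇒≡ᵇ a n (∸≡1⇒≡ a≤1+n (ℕ.≡ᵇ⇒≡ _ 1 (proj₂ (Equivalence.to T-∧ (≡true⇒T selectable))))))
      =
      ℚ.*-comm (θ ^ inv v) (θ ^ (suc n ∸ a))
    last-letter-wins false selectable rewrite selectable = sym (ℚ.*-zeroˡ (θ ^ inv v))

  -- Recurrences in n

  ΣSym-cong : ∀ n {F G : List ℕ → ℚ} → (∀ v → IsPerm n v → F v ≡ G v) → ΣSym n F ≡ ΣSym n G
  ΣSym-cong n {F} {G} F≡G = Σ-words-cong-All (λ x → T (memb x (range 1 n))) (range 1 n) (∈-self (range 1 n)) n on-words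
    where
    on-words : ∀ w → All (λ x → T (memb x (range 1 n))) w → length w ≡ n →
      (if distinct w then F w else 0ℚ) ≡ (if distinct w then G w else 0ℚ)
    on-words w w⊆ |w|≡n with distinct w in unique
    ... | true = F≡G w record { ⊆range = w⊆ ; unique = ≡true⇒T unique ; length≡ = |w|≡n }
    ... | false = refl

  ΣSym-linear : ∀ n (c d : ℚ) (F G : List ℕ → ℚ) →
    ΣSym n (λ v → c * F v + d * G v) ≡ c * ΣSym n F + d * ΣSym n G
  ΣSym-linear n c d F G = begin
    ΣSym n (λ v → c * F v + d * G v)
      ≡⟨ Σ-cong (words (range 1 n) n) if-linear ⟩
    Σ (words (range 1 n) n) (λ w → c * (if distinct w then F w else 0ℚ) + d * (if distinct w then G w else 0ℚ))
      ≡⟨ Σ-+ (words (range 1 n) n) _ _ ⟩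
    Σ (words (range 1 n) n) (λ w → c * (if distinct w then F w else 0ℚ))
      + Σ (words (range 1 n) n) (λ w → d * (if distinct w then G w else 0ℚ))
      ≡⟨ cong₂ _+_ (Σ-*ˡ (words (range 1 n) n) c _) (Σ-*ˡ (words (range 1 n) n) d _) ⟩
    c * ΣSym n F + d * ΣSym n G ∎
    where
    if-linear : ∀ w → (if distinct w then c * F w + d * G w else 0ℚ) ≡
      c * (if distinct w then F w else 0ℚ) + d * (if distinct w then G w else 0ℚ)
    if-linear w with distinct w
    ... | true = refl
    ... | false = sym (trans (cong₂ _+_ (ℚ.*-zeroʳ c) (ℚ.*-zeroʳ d)) (ℚ.+-identityʳ 0ℚ))

  Σ< : ℕ → (ℕ → ℚ) → ℚ
  Σ< zero g = 0ℚ
  Σ< (suc m) g = g m + Σ< m g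

  Σ-range-reversed : ∀ (g : ℕ → ℚ) m i → Σ (range i m) (λ a → g (i ℕ.+ m ∸ suc a)) ≡ Σ< m g
  Σ-range-reversed g zero i = refl
  Σ-range-reversed g (suc m) i rewrite ℕ.+-suc i m | ℕ.m+n∸m≡n i m = cong (g m +_) (Σ-range-reversed g m (suc i))

  -- Summing over the last letter a factors each sum, since the weights depend on a only through j = suc n ∸ a.
  ΣSym-suc-factor : ∀ n (F F₁ F₂ : List ℕ → ℚ) (g₁ g₂ : ℕ → ℚ) →
    (∀ v → IsPerm n v → ∀ a → 1 ≤ a → a ≤ suc n →
       F (extend a v) ≡ g₁ (suc n ∸ a) * F₁ v + g₂ (suc n ∸ a) * F₂ v) →
    ΣSym (suc n) F ≡ Σ< (suc n) g₁ * ΣSym n F₁ + Σ< (suc n) g₂ * ΣSym n F₂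
  ΣSym-suc-factor n F F₁ F₂ g₁ g₂ F-extend = begin
    ΣSym (suc n) F
      ≡⟨ ΣSym-suc n F ⟩
    Σ as (λ a → ΣSym n (F ∘ extend a))
      ≡⟨ Σ-cong-All as (range-bounds 1 (suc n)) (λ a (1≤a , a≤1+n) →
           ΣSym-cong n (λ v v∈Sₙ → F-extend v v∈Sₙ a 1≤a (ℕ.≤-pred a≤1+n))) ⟩
    Σ as (λ a → ΣSym n (λ v → g₁ (suc n ∸ a) * F₁ v + g₂ (suc n ∸ a) * F₂ v))
      ≡⟨ Σ-cong as (λ a → ΣSym-linear n (g₁ (suc n ∸ a)) (g₂ (suc n ∸ a)) F₁ F₂) ⟩
    Σ as (λ a → g₁ (suc n ∸ a) * ΣSym n F₁ + g₂ (suc n ∸ a) * ΣSym n F₂)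
      ≡⟨ Σ-+ as (λ a → g₁ (suc n ∸ a) * ΣSym n F₁) (λ a → g₂ (suc n ∸ a) * ΣSym n F₂) ⟩
    Σ as (λ a → g₁ (suc n ∸ a) * ΣSym n F₁) + Σ as (λ a → g₂ (suc n ∸ a) * ΣSym n F₂)
      ≡⟨ cong₂ _+_ (factor g₁ (ΣSym n F₁)) (factor g₂ (ΣSym n F₂)) ⟩
    Σ< (suc n) g₁ * ΣSym n F₁ + Σ< (suc n) g₂ * ΣSym n F₂ ∎
    where
    as = range 1 (suc n)
    factor : ∀ g x → Σ as (λ a → g (suc n ∸ a) * x) ≡ Σ< (suc n) g * x
    factor g x = trans (Σ-*ʳ as (λ a → g (suc n ∸ a)) x) (cong (_* x) (Σ-range-reversed g (suc n) 1))

  Σ<-zero : ∀ m → Σ< m (λ _ → 0ℚ) ≡ 0ℚ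
  Σ<-zero zero = refl
  Σ<-zero (suc m) rewrite Σ<-zero m = refl

  T2-suc : ∀ θ k n → T2 θ (suc n) k ≡ Σ< (suc n) (skipWeight θ (k ≤ᵇ n)) * T2 θ n k
  T2-suc θ k n = begin
    T2 θ (suc n) k
      ≡⟨ T2≡ΣSym θ (suc n) k ⟩
    ΣSym (suc n) (weightT θ k)
      ≡⟨ ΣSym-suc-factor n (weightT θ k) (weightT θ k) (weightT θ k) (skipWeight θ (k ≤ᵇ n)) (λ _ → 0ℚ)
           (λ v v∈Sₙ a 1≤a a≤1+n → trans (weightT-extend θ k v∈Sₙ a 1≤a a≤1+n)
             (sym (+-*-zeroˡ (skipWeight θ (k ≤ᵇ n) (suc n ∸ a) * weightT θ k v) (weightT θ k v)))) ⟩
    Σ< (suc n) (skipWeight θ (k ≤ᵇ n)) * ΣSym n (weightT θ k) + Σ< (suc n) (λ _ → 0ℚ) * ΣSym n (weightT θ k)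
      ≡⟨ cong (λ z → Σ< (suc n) (skipWeight θ (k ≤ᵇ n)) * ΣSym n (weightT θ k) + z * ΣSym n (weightT θ k))
              (Σ<-zero (suc n)) ⟩
    Σ< (suc n) (skipWeight θ (k ≤ᵇ n)) * ΣSym n (weightT θ k) + 0ℚ * ΣSym n (weightT θ k)
      ≡⟨ +-*-zeroˡ (Σ< (suc n) (skipWeight θ (k ≤ᵇ n)) * ΣSym n (weightT θ k)) (ΣSym n (weightT θ k)) ⟩
    Σ< (suc n) (skipWeight θ (k ≤ᵇ n)) * ΣSym n (weightT θ k)
      ≡⟨ cong (Σ< (suc n) (skipWeight θ (k ≤ᵇ n)) *_) (T2≡ΣSym θ n k) ⟨
    Σ< (suc n) (skipWeight θ (k ≤ᵇ n)) * T2 θ n k ∎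

  W2-suc : ∀ θ k n →
    W2 θ (suc n) k ≡ Σ< (suc n) (keepWinWeight θ) * W2 θ n k + Σ< (suc n) (newWinWeight θ (k ≤ᵇ n)) * T2 θ n k
  W2-suc θ k n = begin
    W2 θ (suc n) k
      ≡⟨ W2≡ΣSym θ (suc n) k ⟩
    ΣSym (suc n) (weightW θ (suc n) k)
      ≡⟨ ΣSym-suc-factor n (weightW θ (suc n) k) (weightW θ n k) (weightT θ k)
           (keepWinWeight θ) (newWinWeight θ (k ≤ᵇ n)) (λ v v∈Sₙ → weightW-extend θ k v∈Sₙ) ⟩
    Σ< (suc n) (keepWinWeight θ) * ΣSym n (weightW θ n k) + Σ< (suc n) (newWinWeight θ (k ≤ᵇ n)) * ΣSym n (weightT θ k)
      ≡⟨ cong₂ (λ w t → Σ< (suc n) (keepWinWeight θ) * w + Σ< (suc n) (newWinWeight θ (k ≤ᵇ n)) * t)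
               (W2≡ΣSym θ n k) (T2≡ΣSym θ n k) ⟨
    Σ< (suc n) (keepWinWeight θ) * W2 θ n k + Σ< (suc n) (newWinWeight θ (k ≤ᵇ n)) * T2 θ n k ∎

  P-suc : ∀ θ m → P θ (suc m) ≡ P θ m + θ ^ m
  P-suc θ m = begin
    P θ (suc m)                    ≡⟨ cong (λ js → Σ js (θ ^_)) (List.applyUpTo-∷ʳ id m) ⟨
    Σ (upTo m ∷ʳ m) (θ ^_)         ≡⟨ Σ-++ (upTo m) (m ∷ []) (θ ^_) ⟩
    P θ m + (θ ^ m + 0ℚ)           ≡⟨ cong (P θ m +_) (ℚ.+-identityʳ (θ ^ m)) ⟩
    P θ m + θ ^ m                  ∎

  Σ<-^ : ∀ θ m → Σ< m (θ ^_) ≡ P θ m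
  Σ<-^ θ zero = refl
  Σ<-^ θ (suc m) rewrite Σ<-^ θ m | P-suc θ m = ℚ.+-comm (θ ^ m) (P θ m)

  1+θ²P : ℚ → ℕ → ℚ
  1+θ²P θ j = 1ℚ + θ ^ 2 * P θ j

  Σ<-skipWeight : ∀ θ m → Σ< (suc (suc m)) (skipWeight θ true) ≡ 1+θ²P θ m
  Σ<-skipWeight θ zero =
    solve 1 (λ t → con 0ℚ :+ (con 1ℚ :+ con 0ℚ) := con 1ℚ :+ t :* (t :* con 1ℚ) :* con 0ℚ) refl θ
  Σ<-skipWeight θ (suc m) rewrite Σ<-skipWeight θ m | P-suc θ m =
    solve 3 (λ t p q → t :* (t :* q) :+ (con 1ℚ :+ t :* (t :* con 1ℚ) :* p) := con 1ℚ :+ t :* (t :* con 1ℚ) :* (p :+ q))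
      refl θ (P θ m) (θ ^ m)

  Σ<-keepWinWeight : ∀ θ m → Σ< (suc (suc m)) (keepWinWeight θ) ≡ θ ^ 2 * P θ m
  Σ<-keepWinWeight θ zero = solve 1 (λ t → con 0ℚ :+ (con 0ℚ :+ con 0ℚ) := t :* (t :* con 1ℚ) :* con 0ℚ) refl θ
  Σ<-keepWinWeight θ (suc m) rewrite Σ<-keepWinWeight θ m | P-suc θ m =
    solve 3 (λ t p q → t :* (t :* q) :+ t :* (t :* con 1ℚ) :* p := t :* (t :* con 1ℚ) :* (p :+ q)) refl θ (P θ m) (θ ^ m)

  Σ<-newWinWeight : ∀ θ m → Σ< (suc (suc m)) (newWinWeight θ true) ≡ θ
  Σ<-newWinWeight θ zero = solve 1 (λ t → t :* con 1ℚ :+ (con 0ℚ :+ con 0ℚ) := t) refl θ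
  Σ<-newWinWeight θ (suc m) rewrite Σ<-newWinWeight θ m = ℚ.+-identityˡ θ

  T2-suc-< : ∀ θ {k n} → n < k → T2 θ (suc n) k ≡ P θ (suc n) * T2 θ n k
  T2-suc-< θ {k} {n} n<k rewrite T2-suc θ k n | ¬T⇒≡false (ℕ.<⇒≱ n<k ∘ ℕ.≤ᵇ⇒≤ k n) =
    cong (_* T2 θ n k) (Σ<-^ θ (suc n))

  W2-suc-< : ∀ θ {k n} → n < k → W2 θ (suc n) k ≡ Σ< (suc n) (keepWinWeight θ) * W2 θ n k
  W2-suc-< θ {k} {n} n<k rewrite W2-suc θ k n | ¬T⇒≡false (ℕ.<⇒≱ n<k ∘ ℕ.≤ᵇ⇒≤ k n) =
    trans (cong (λ c → Σ< (suc n) (keepWinWeight θ) * W2 θ n k + c * T2 θ n k) (Σ<-zero (suc n)))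
          (+-*-zeroˡ (Σ< (suc n) (keepWinWeight θ) * W2 θ n k) (T2 θ n k))

  T2-suc-≥ : ∀ θ {k m} → k ≤ suc m → T2 θ (suc (suc m)) k ≡ 1+θ²P θ m * T2 θ (suc m) k
  T2-suc-≥ θ {k} {m} k≤1+m rewrite T2-suc θ k (suc m) | T⇒≡true (ℕ.≤⇒≤ᵇ k≤1+m) =
    cong (_* T2 θ (suc m) k) (Σ<-skipWeight θ m)

  W2-suc-≥ : ∀ θ {k m} → k ≤ suc m →
    W2 θ (suc (suc m)) k ≡ θ ^ 2 * P θ m * W2 θ (suc m) k + θ * T2 θ (suc m) k
  W2-suc-≥ θ {k} {m} k≤1+m rewrite W2-suc θ k (suc m) | T⇒≡true (ℕ.≤⇒≤ᵇ k≤1+m) =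
    cong₂ (λ x y → x * W2 θ (suc m) k + y * T2 θ (suc m) k) (Σ<-keepWinWeight θ m) (Σ<-newWinWeight θ m)

  -- Closed forms

  prodFrom : (ℕ → ℚ) → ℕ → ℕ → ℚ
  prodFrom f a m = prodℚ (map f (applyUpTo (a ℕ.+_) m))

  prodℚ-∷ʳ : ∀ xs x → prodℚ (xs ∷ʳ x) ≡ prodℚ xs * x
  prodℚ-∷ʳ [] x = trans (ℚ.*-identityʳ x) (sym (ℚ.*-identityˡ x))
  prodℚ-∷ʳ (y ∷ xs) x = trans (cong (y *_) (prodℚ-∷ʳ xs x)) (sym (ℚ.*-assoc y (prodℚ xs) x))

  prodFrom-suc : ∀ f a m → prodFrom f a (suc m) ≡ prodFrom f a m * f (a ℕ.+ m)
  prodFrom-suc f a m = begin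
    prodFrom f a (suc m)
      ≡⟨ cong (prodℚ ∘ map f) (List.applyUpTo-∷ʳ (a ℕ.+_) m) ⟨
    prodℚ (map f (applyUpTo (a ℕ.+_) m ∷ʳ (a ℕ.+ m)))
      ≡⟨ cong prodℚ (List.map-++ f (applyUpTo (a ℕ.+_) m) (a ℕ.+ m ∷ [])) ⟩
    prodℚ (map f (applyUpTo (a ℕ.+_) m) ∷ʳ f (a ℕ.+ m))
      ≡⟨ prodℚ-∷ʳ (map f (applyUpTo (a ℕ.+_) m)) (f (a ℕ.+ m)) ⟩
    prodFrom f a m * f (a ℕ.+ m) ∎

  T2-small : ∀ θ {k} n → n ≤ k → T2 θ n k ≡ Pfact θ n
  T2-small θ zero _ = refl
  T2-small θ (suc n) n<k = trans (T2-suc-< θ n<k) (cong (P θ (suc n) *_) (T2-small θ n (ℕ.<⇒≤ n<k)))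

  W2-small : ∀ θ {k} n → n ≤ k → W2 θ n k ≡ 0ℚ
  W2-small θ zero _ = refl
  W2-small θ (suc n) n<k = trans (W2-suc-< θ n<k)
    (trans (cong (Σ< (suc n) (keepWinWeight θ) *_) (W2-small θ n (ℕ.<⇒≤ n<k)))
           (ℚ.*-zeroʳ (Σ< (suc n) (keepWinWeight θ))))

  T2-large : ∀ θ k′ d → T2 θ (suc k′ ℕ.+ d) (suc k′) ≡ Pfact θ (suc k′) * prodFrom (1+θ²P θ) k′ d
  T2-large θ k′ zero rewrite ℕ.+-identityʳ k′ = trans (T2-small θ (suc k′) ℕ.≤-refl) (sym (ℚ.*-identityʳ _))
  T2-large θ k′ (suc d) rewrite ℕ.+-suc k′ d = begin
    T2 θ (suc (suc (k′ ℕ.+ d))) (suc k′)     ≡⟨ T2-suc-≥ θ (s≤s (ℕ.m≤m+n k′ d)) ⟩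
    G * T2 θ (suc k′ ℕ.+ d) (suc k′)         ≡⟨ cong (G *_) (T2-large θ k′ d) ⟩
    G * (Pk * Gs)                            ≡⟨ ℚ*.x∙yz≈y∙zx G Pk Gs ⟩
    Pk * (Gs * G)                            ≡⟨ cong (Pk *_) (prodFrom-suc (1+θ²P θ) k′ d) ⟨
    Pk * prodFrom (1+θ²P θ) k′ (suc d)       ∎
    where
    G = 1+θ²P θ (k′ ℕ.+ d)
    Pk = Pfact θ (suc k′)
    Gs = prodFrom (1+θ²P θ) k′ d

  W2-large : ∀ θ k′ d → W2 θ (suc k′ ℕ.+ d) (suc k′)
    ≡ θ * Pfact θ (suc k′) * (prodFrom (1+θ²P θ) k′ d - (θ ^ 2) ^ d * prodFrom (P θ) k′ d)
  W2-large θ k′ zero rewrite ℕ.+-identityʳ k′ = trans (W2-small θ (suc k′) ℕ.≤-refl)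
    (solve 2 (λ t p → con 0ℚ := t :* p :* (con 1ℚ :- con 1ℚ :* con 1ℚ)) refl θ (Pfact θ (suc k′)))
  W2-large θ k′ (suc d) rewrite ℕ.+-suc k′ d = begin
    W2 θ (suc (suc (k′ ℕ.+ d))) k
      ≡⟨ W2-suc-≥ θ (s≤s (ℕ.m≤m+n k′ d)) ⟩
    θ ^ 2 * Pn * W2 θ (suc k′ ℕ.+ d) k + θ * T2 θ (suc k′ ℕ.+ d) k
      ≡⟨ cong₂ (λ w t → θ ^ 2 * Pn * w + θ * t) (W2-large θ k′ d) (T2-large θ k′ d) ⟩
    θ ^ 2 * Pn * (θ * Pk * (Gs - θ²ᵈ * Ps)) + θ * (Pk * Gs)
      ≡⟨ solve 6 (λ t q p a x b → t :* (t :* con 1ℚ) :* q :* (t :* p :* (a :- x :* b)) :+ t :* (p :* a)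
                   := t :* p :* (a :* (con 1ℚ :+ t :* (t :* con 1ℚ) :* q) :- (t :* (t :* con 1ℚ)) :* x :* (b :* q)))
                 refl θ Pn Pk Gs θ²ᵈ Ps ⟩
    θ * Pk * (Gs * 1+θ²P θ (k′ ℕ.+ d) - (θ ^ 2) ^ suc d * (Ps * Pn))
      ≡⟨ cong₂ (λ g p → θ * Pk * (g - (θ ^ 2) ^ suc d * p))
               (prodFrom-suc (1+θ²P θ) k′ d) (prodFrom-suc (P θ) k′ d) ⟨
    θ * Pk * (prodFrom (1+θ²P θ) k′ (suc d) - (θ ^ 2) ^ suc d * prodFrom (P θ) k′ (suc d)) ∎
    where
    k = suc k′
    Pk = Pfact θ k
    Gs = prodFrom (1+θ²P θ) k′ d
    Ps = prodFrom (P θ) k′ d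
    Pn = P θ (k′ ℕ.+ d)
    θ²ᵈ = (θ ^ 2) ^ d

  Pfact*P*P≡Pfact*prodFrom : ∀ θ k′ d →
    Pfact θ (k′ ℕ.+ d) * P θ (suc k′) * P θ k′ ≡ Pfact θ (suc k′) * prodFrom (P θ) k′ (suc d)
  Pfact*P*P≡Pfact*prodFrom θ k′ zero rewrite ℕ.+-identityʳ k′ =
    solve 3 (λ f p q → f :* p :* q := p :* f :* (q :* con 1ℚ)) refl (Pfact θ k′) (P θ (suc k′)) (P θ k′)
  Pfact*P*P≡Pfact*prodFrom θ k′ (suc d) = begin
    Pfact θ (k′ ℕ.+ suc d) * P θ (suc k′) * P θ k′
      ≡⟨ cong (λ m → Pfact θ m * P θ (suc k′) * P θ k′) (ℕ.+-suc k′ d) ⟩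
    P θ (suc (k′ ℕ.+ d)) * Pfact θ (k′ ℕ.+ d) * P θ (suc k′) * P θ k′
      ≡⟨ solve 4 (λ r f p q → r :* f :* p :* q := (f :* p :* q) :* r) refl
           (P θ (suc (k′ ℕ.+ d))) (Pfact θ (k′ ℕ.+ d)) (P θ (suc k′)) (P θ k′) ⟩
    Pfact θ (k′ ℕ.+ d) * P θ (suc k′) * P θ k′ * P θ (suc (k′ ℕ.+ d))
      ≡⟨ cong₂ _*_ (Pfact*P*P≡Pfact*prodFrom θ k′ d) (cong (P θ) (sym (ℕ.+-suc k′ d))) ⟩
    Pfact θ (suc k′) * prodFrom (P θ) k′ (suc d) * P θ (k′ ℕ.+ suc d)
      ≡⟨ ℚ.*-assoc (Pfact θ (suc k′)) (prodFrom (P θ) k′ (suc d)) (P θ (k′ ℕ.+ suc d)) ⟩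
    Pfact θ (suc k′) * (prodFrom (P θ) k′ (suc d) * P θ (k′ ℕ.+ suc d))
      ≡⟨ cong (Pfact θ (suc k′) *_) (prodFrom-suc (P θ) k′ (suc d)) ⟨
    Pfact θ (suc k′) * prodFrom (P θ) k′ (suc (suc d)) ∎

  prodFromTo≡prodFrom : ∀ f a d → prodFromTo f a (a ℕ.+ d) ≡ prodFrom f a (suc d)
  prodFromTo≡prodFrom f a d = cong (prodℚ ∘ map f ∘ applyUpTo (a ℕ.+_))
    (trans (cong (_∸ a) (sym (ℕ.+-suc a d))) (ℕ.m+n∸m≡n a (suc d)))

  θ^[2N∸2k]≡ : ∀ θ k′ d → θ ^ (2 ℕ.* (suc (suc k′) ℕ.+ d) ∸ 2 ℕ.* suc k′) ≡ (θ ^ 2) ^ suc d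
  θ^[2N∸2k]≡ θ k′ d = begin
    θ ^ (2 ℕ.* (suc (suc k′) ℕ.+ d) ∸ 2 ℕ.* suc k′) ≡⟨ cong (θ ^_) (ℕ.*-distribˡ-∸ 2 (suc (suc k′) ℕ.+ d) (suc k′)) ⟨
    θ ^ (2 ℕ.* (suc k′ ℕ.+ d ∸ k′))                 ≡⟨ cong (λ m → θ ^ (2 ℕ.* m)) N∸k≡1+d ⟩
    θ ^ (2 ℕ.* suc d)                              ≡⟨ cong (θ ^_) (ℕ.*-comm 2 (suc d)) ⟩
    θ ^ (suc d ℕ.* 2)                              ≡⟨ ^-* θ (suc d) 2 ⟩
    (θ ^ 2) ^ suc d                                ∎
    where
    N∸k≡1+d : suc k′ ℕ.+ d ∸ k′ ≡ suc d
    N∸k≡1+d = trans (cong (_∸ k′) (sym (ℕ.+-suc k′ d))) (ℕ.m+n∸m≡n k′ (suc d))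

  T2-above : ∀ θ k′ d →
    T2 θ (suc (suc k′) ℕ.+ d) (suc k′) ≡ Pfact θ (suc k′) * prodFrom (1+θ²P θ) k′ (suc d)
  T2-above θ k′ d = trans (cong (λ n → T2 θ (suc n) (suc k′)) (sym (ℕ.+-suc k′ d))) (T2-large θ k′ (suc d))

  W2-above : ∀ θ k′ d → W2 θ (suc (suc k′) ℕ.+ d) (suc k′)
    ≡ θ * Pfact θ (suc k′) * (prodFrom (1+θ²P θ) k′ (suc d) - (θ ^ 2) ^ suc d * prodFrom (P θ) k′ (suc d))
  W2-above θ k′ d = trans (cong (λ n → W2 θ (suc n) (suc k′)) (sym (ℕ.+-suc k′ d))) (W2-large θ k′ (suc d))

  W2-closed : ∀ θ k′ d → let N = suc (suc k′) ℕ.+ d; k = suc k′ in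
    W2 θ N k ≡ θ * Pfact θ k * (prodFromTo (1+θ²P θ) k′ (k′ ℕ.+ d)
                                - θ ^ (2 ℕ.* N ∸ 2 ℕ.* k) * prodFromTo (P θ) k′ (k′ ℕ.+ d))
  W2-closed θ k′ d = begin
    W2 θ (suc (suc k′) ℕ.+ d) (suc k′)
      ≡⟨ W2-above θ k′ d ⟩
    θ * Pk * (prodFrom (1+θ²P θ) k′ (suc d) - (θ ^ 2) ^ suc d * prodFrom (P θ) k′ (suc d))
      ≡⟨ cong₂ (λ g p → θ * Pk * (g - (θ ^ 2) ^ suc d * p))
               (prodFromTo≡prodFrom (1+θ²P θ) k′ d) (prodFromTo≡prodFrom (P θ) k′ d) ⟨
    θ * Pk * (prodFromTo (1+θ²P θ) k′ (k′ ℕ.+ d) - (θ ^ 2) ^ suc d * prodFromTo (P θ) k′ (k′ ℕ.+ d))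
      ≡⟨ cong (λ x → θ * Pk * (prodFromTo (1+θ²P θ) k′ (k′ ℕ.+ d) - x * prodFromTo (P θ) k′ (k′ ℕ.+ d)))
              (θ^[2N∸2k]≡ θ k′ d) ⟨
    θ * Pk * (prodFromTo (1+θ²P θ) k′ (k′ ℕ.+ d)
              - θ ^ (2 ℕ.* (suc (suc k′) ℕ.+ d) ∸ 2 ℕ.* suc k′) * prodFromTo (P θ) k′ (k′ ℕ.+ d)) ∎
    where
    Pk = Pfact θ (suc k′)

  W2≡θT2-correction : ∀ θ k′ d → let N = suc (suc k′) ℕ.+ d; k = suc k′ in
    W2 θ N k ≡ θ * T2 θ N k - θ ^ (2 ℕ.* N ∸ 2 ℕ.* k ℕ.+ 1) * Pfact θ (k′ ℕ.+ d) * P θ k * P θ k′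
  W2≡θT2-correction θ k′ d = sym (begin
    θ * T2 θ N k - θ ^ (E ℕ.+ 1) * Pf * P θ k * P θ k′
      ≡⟨ cong₂ (λ t y → θ * t - y * Pf * P θ k * P θ k′) (T2-above θ k′ d) (^-+ θ E 1) ⟩
    θ * (Pk * Gs) - θ ^ E * (θ * 1ℚ) * Pf * P θ k * P θ k′
      ≡⟨ cong (λ y → θ * (Pk * Gs) - y * (θ * 1ℚ) * Pf * P θ k * P θ k′) (θ^[2N∸2k]≡ θ k′ d) ⟩
    θ * (Pk * Gs) - θ²ᵈ * (θ * 1ℚ) * Pf * P θ k * P θ k′
      ≡⟨ solve 7 (λ t p a x f c q → t :* (p :* a) :- x :* (t :* con 1ℚ) :* f :* c :* q
                    := t :* (p :* a) :- x :* t :* (f :* c :* q)) refl θ Pk Gs θ²ᵈ Pf (P θ k) (P θ k′) ⟩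
    θ * (Pk * Gs) - θ²ᵈ * θ * (Pf * P θ k * P θ k′)
      ≡⟨ cong (λ z → θ * (Pk * Gs) - θ²ᵈ * θ * z) (Pfact*P*P≡Pfact*prodFrom θ k′ d) ⟩
    θ * (Pk * Gs) - θ²ᵈ * θ * (Pk * Ps)
      ≡⟨ solve 5 (λ t p a x b → t :* (p :* a) :- x :* t :* (p :* b) := t :* p :* (a :- x :* b)) refl θ Pk Gs θ²ᵈ Ps ⟩
    θ * Pk * (Gs - θ²ᵈ * Ps)
      ≡⟨ W2-above θ k′ d ⟨
    W2 θ N k ∎)
    where
    N = suc (suc k′) ℕ.+ d
    k = suc k′
    E = 2 ℕ.* N ∸ 2 ℕ.* k
    Pf = Pfact θ (k′ ℕ.+ d)
    Pk = Pfact θ k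
    Gs = prodFrom (1+θ²P θ) k′ (suc d)
    Ps = prodFrom (P θ) k′ (suc d)
    θ²ᵈ = (θ ^ 2) ^ suc d

open SecondMaximumStrategy using (W2-closed; W2≡θT2-correction)

open import Data.Nat as Nat using (ℕ; _≤_; _∸_)
open import Data.Rational using (ℚ; 0ℚ; 1ℚ; _+_; _*_; _-_; _<_)
open import Data.Product using (_×_; _,_)
open import Relation.Binary.PropositionalEquality using (_≡_; refl)
import Data.Nat.Properties as ℕ

-- The identities are polynomial in θ.
theorem8 : (θ : ℚ) → 0ℚ < θ → (k N : ℕ) → 1 ≤ k → Nat.suc k ≤ N →
    (W2 θ N k ≡ θ * T2 θ N k - θ ^ (2 Nat.* N ∸ 2 Nat.* k Nat.+ 1) * Pfact θ (N ∸ 2) * P θ k * P θ (k ∸ 1))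
    × (W2 θ N k ≡ θ * Pfact θ k
         * (prodFromTo (λ j → 1ℚ + θ ^ 2 * P θ j) (k ∸ 1) (N ∸ 2)
            - θ ^ (2 Nat.* N ∸ 2 Nat.* k) * prodFromTo (P θ) (k ∸ 1) (N ∸ 2)))
theorem8 θ _ (Nat.suc k′) N (Nat.s≤s Nat.z≤n) k<N with ℕ.m≤n⇒∃[o]m+o≡n k<N
... | d , refl = W2≡θT2-correction θ k′ d , W2-closed θ k′ d
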